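{- Let $\alpha \ge 0$ and let $k \ge 1$. Suppose there exists an $\alpha$-unfair polynomial $c(x)$ with a factorization $c(x) = a(x) b(x)$ witnessing $\alpha$-unfairness in which $a(x)$ has degree $k$. Then for all integers $i \ge 1$ and $0 \le j \le i-1$ there exists an $\alpha$-unfair polynomial $C(x)$ with a factorization $C(x) = A(x) B(x)$ witnessing $\alpha$-unfairness in which $A(x)$ has degree $ik + j$.
   Context: Let $\alpha \ge 0$. A polynomial $c(x) = \sum c_i x^i$ with all $c_i \in \{0,1\}$ is called $\alpha$-unfair if there exists a factorization $c(x) = a(x) b(x)$ with real polynomials $a(x) = \sum a_i x^i$, $b(x) = \sum b_i x^i$ such that: $a_0 = b_0 = 1$; there exists an index $i$ with $b_i \notin \{0,1\}$; every coefficient $b_i$ satisfies $-\alpha \le b_i \le 1+\alpha$; and every coefficient $a_i$ satisfies $-\alpha \le a_i \le 1+\alpha$. Such a factorization is said to witness $\alpha$-unfairness, and $a(x)$ is then called a factor of the $\alpha$-unfair polynomial. -}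

module Defs where

open import Level using (0ℓ)
open import Data.Nat as ℕ using (ℕ; zero; suc; _∸_)
open import Data.List using (List; []; _∷_)
open import Data.Product using (Σ; ∃; _×_; _,_)
open import Data.Sum using (_⊎_)
open import Relation.Nullary using (¬_)
open import Relation.Binary.PropositionalEquality using (_≡_; _≢_)
open import Algebra.Structures using (IsCommutativeRing)
open import Relation.Binary.Structures using (IsTotalOrder)

-- The real numbers, axiomatised as a complete (Dedekind / least-upper-bound)
-- ordered field with propositional equality.  Any model is (classically)
-- isomorphic to ℝ, so quantifying over all models states the result for ℝ.
record RealField : Set₁ where
  infixl 6 _+_
  infixl 7 _*_
  infix 4 _≤_
  field
    Carrier : Set
    _+_ _*_ : Carrier → Carrier → Carrier
    -_      : Carrier → Carrier
    0# 1#   : Carrier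
    _≤_     : Carrier → Carrier → Set
    isCommutativeRing : IsCommutativeRing _≡_ _+_ _*_ -_ 0# 1#
    0≢1     : 0# ≢ 1#
    inverse : ∀ x → x ≢ 0# → ∃ λ y → x * y ≡ 1#
    isTotalOrder : IsTotalOrder _≡_ _≤_
    +-mono-≤ : ∀ {x y} z → x ≤ y → x + z ≤ y + z
    *-nonneg : ∀ {x y} → 0# ≤ x → 0# ≤ y → 0# ≤ x * y
    lub : (S : Carrier → Set) → (∃ λ x → S x) →
          (∃ λ u → ∀ x → S x → x ≤ u) →
          ∃ λ s → (∀ x → S x → x ≤ s) × (∀ u → (∀ x → S x → x ≤ u) → s ≤ u)

module Poly (ℝ : RealField) where
  open RealField ℝ

  -- A real polynomial, given by its coefficient list (constant term first).
  Polynomial : Set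
  Polynomial = List Carrier

  coeff : Polynomial → ℕ → Carrier
  coeff []       _       = 0#
  coeff (c ∷ cs) zero    = c
  coeff (c ∷ cs) (suc i) = coeff cs i

  convSum : Polynomial → Polynomial → ℕ → ℕ → Carrier
  convSum a b n zero    = coeff a 0 * coeff b n
  convSum a b n (suc m) = convSum a b n m + coeff a (suc m) * coeff b (n ∸ suc m)

  mulCoeff : Polynomial → Polynomial → ℕ → Carrier
  mulCoeff a b n = convSum a b n n

  IsProduct : Polynomial → Polynomial → Polynomial → Set
  IsProduct c a b = ∀ n → coeff c n ≡ mulCoeff a b n

  HasDegree : Polynomial → ℕ → Set
  HasDegree a d = (coeff a d ≢ 0#) × (∀ m → d ℕ.< m → coeff a m ≡ 0#)

  ZeroOne : Polynomial → Set
  ZeroOne c = ∀ n → (coeff c n ≡ 0#) ⊎ (coeff c n ≡ 1#)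

  Bounded : Carrier → Polynomial → Set
  Bounded α p = ∀ n → ((- α) ≤ coeff p n) × (coeff p n ≤ 1# + α)

  Witnesses : Carrier → Polynomial → Polynomial → Polynomial → Set
  Witnesses α c a b =
    ZeroOne c × IsProduct c a b ×
    (coeff a 0 ≡ 1#) × (coeff b 0 ≡ 1#) ×
    (∃ λ i → (coeff b i ≢ 0#) × (coeff b i ≢ 1#)) ×
    Bounded α b × Bounded α a

  UnfairWithFactorDegree : Carrier → ℕ → Set
  UnfairWithFactorDegree α d =
    Σ Polynomial λ c → Σ Polynomial λ a → Σ Polynomial λ b →
      Witnesses α c a b × HasDegree a d

module _ (ℝ : RealField) where
  open RealField ℝ using (Carrier; 0#) renaming (_≤_ to _≤ᵣ_)
  open Poly ℝ

  Theorem2 : Set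
  Theorem2 =
    (α : Carrier) → 0# ≤ᵣ α → (k : ℕ) → 1 ℕ.≤ k →
    UnfairWithFactorDegree α k →
    (i j : ℕ) → 1 ℕ.≤ i → j ℕ.< i →
    UnfairWithFactorDegree α (i ℕ.* k ℕ.+ j)

-- With i = p + 1, take A(x) = a(xⁱ)(1 + x + ⋯ + xʲ), B(x) = b(xⁱ) and C(x) = c(xⁱ)(1 + x + ⋯ + xʲ),
-- so that C = A B and deg A = i k + j. Because j < i, every coefficient of C, A and B sits in a
-- residue class modulo i on which it is a coefficient of c, a, b respectively, or is zero; hence
-- the 0/1 pattern, the bounds, the leading coefficients and the non-{0,1} coefficient of b all
-- carry over. Zero is admissible everywhere since every polynomial has zero coefficients beyond its
-- length, which is why neither α ≥ 0 nor k ≥ 1 is needed.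
module Submission where

open import Defs
open import Data.Nat as ℕ using (ℕ; zero; suc; _∸_; z≤n; s≤s)
import Data.Nat.Properties as ℕₚ
open import Data.Nat.DivMod using (_%_; _/_; m≡m%n+[m/n]*n; m%n<n)
open import Data.List using ([]; _∷_; _++_; replicate; length)
open import Data.Product using (_×_; _,_)
open import Data.Sum using (_⊎_)
open import Function using (_∘_)
open import Relation.Nullary using (yes; no)
open import Relation.Binary.PropositionalEquality
open import Algebra.Structures using (IsCommutativeRing)

module Convolution (ℝ : RealField) where
  open RealField ℝ
  open Poly ℝ
  open IsCommutativeRing isCommutativeRing
    using (+-assoc; +-comm; *-comm; +-identityˡ; +-identityʳ; zeroˡ)
  open ≡-Reasoning

  Series : Set
  Series = ℕ → Carrier

  shift : Series → Series
  shift f zero    = 0#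
  shift f (suc n) = f n

  shift-cong : ∀ {f g} → f ≗ g → shift f ≗ shift g
  shift-cong f≗g zero    = refl
  shift-cong f≗g (suc n) = f≗g n

  shiftBy : ℕ → Series → Series
  shiftBy zero    f = f
  shiftBy (suc m) f = shift (shiftBy m f)

  shiftBy-< : ∀ m f {n} → n ℕ.< m → shiftBy m f n ≡ 0#
  shiftBy-< (suc m) f {zero}  _         = refl
  shiftBy-< (suc m) f {suc n} (s≤s n<m) = shiftBy-< m f n<m

  shiftBy-+ : ∀ m f n → shiftBy m f (m ℕ.+ n) ≡ f n
  shiftBy-+ zero    f n = refl
  shiftBy-+ (suc m) f n = shiftBy-+ m f n

  shiftBy-section : ∀ m f {r} → r ℕ.< m →
                    ∀ q → shiftBy m f (q ℕ.* m ℕ.+ r) ≡ shift (λ q → f (q ℕ.* m ℕ.+ r)) q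
  shiftBy-section m f     r<m zero    = shiftBy-< m f r<m
  shiftBy-section m f {r} r<m (suc q) =
    trans (cong (shiftBy m f) (ℕₚ.+-assoc m (q ℕ.* m) r)) (shiftBy-+ m f (q ℕ.* m ℕ.+ r))

  sumTo : Series → ℕ → Carrier
  sumTo f zero    = f 0
  sumTo f (suc m) = sumTo f m + f (suc m)

  sumTo-cong : ∀ {f g} m → (∀ {t} → t ℕ.≤ m → f t ≡ g t) → sumTo f m ≡ sumTo g m
  sumTo-cong zero    f≡g = f≡g z≤n
  sumTo-cong (suc m) f≡g = cong₂ _+_ (sumTo-cong m (f≡g ∘ ℕₚ.m≤n⇒m≤1+n)) (f≡g ℕₚ.≤-refl)

  sumTo-sucˡ : ∀ f m → sumTo f (suc m) ≡ f 0 + sumTo (f ∘ suc) m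
  sumTo-sucˡ f zero    = refl
  sumTo-sucˡ f (suc m) =
    trans (cong (_+ f (suc (suc m))) (sumTo-sucˡ f m)) (+-assoc _ _ _)

  sumTo-reverse : ∀ f m → sumTo f m ≡ sumTo (λ t → f (m ∸ t)) m
  sumTo-reverse f zero    = refl
  sumTo-reverse f (suc m) = begin
    sumTo f (suc m)                        ≡⟨ sumTo-sucˡ f m ⟩
    f 0 + sumTo (f ∘ suc) m                ≡⟨ cong (f 0 +_) (sumTo-reverse (f ∘ suc) m) ⟩
    f 0 + sumTo (λ t → f (suc (m ∸ t))) m  ≡⟨ +-comm _ _ ⟩
    sumTo (λ t → f (suc (m ∸ t))) m + f 0
      ≡⟨ cong₂ _+_ (sumTo-cong m λ t≤m → cong f (sym (ℕₚ.+-∸-assoc 1 t≤m)))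
                   (cong f (sym (ℕₚ.n∸n≡0 m))) ⟩
    sumTo (λ t → f (suc m ∸ t)) (suc m)    ∎

  convSum-sumTo : ∀ a b n m → convSum a b n m ≡ sumTo (λ t → coeff a t * coeff b (n ∸ t)) m
  convSum-sumTo a b n zero    = refl
  convSum-sumTo a b n (suc m) =
    cong (_+ coeff a (suc m) * coeff b (n ∸ suc m)) (convSum-sumTo a b n m)

  mulCoeff-comm : ∀ a b → mulCoeff a b ≗ mulCoeff b a
  mulCoeff-comm a b n = begin
    mulCoeff a b n                                        ≡⟨ convSum-sumTo a b n n ⟩
    sumTo (λ t → coeff a t * coeff b (n ∸ t)) n           ≡⟨ sumTo-reverse _ n ⟩
    sumTo (λ t → coeff a (n ∸ t) * coeff b (n ∸ (n ∸ t))) n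
      ≡⟨ sumTo-cong n (λ {t} t≤n → trans (cong (λ s → coeff a (n ∸ t) * coeff b s) (ℕₚ.m∸[m∸n]≡n t≤n))
                                         (*-comm _ _)) ⟩
    sumTo (λ t → coeff b t * coeff a (n ∸ t)) n           ≡⟨ sym (convSum-sumTo b a n n) ⟩
    mulCoeff b a n                                        ∎

  mulCoeff-[]ˡ : ∀ b n → mulCoeff [] b n ≡ 0#
  mulCoeff-[]ˡ b n = convSum-[]ˡ n
    where
    convSum-[]ˡ : ∀ m → convSum [] b n m ≡ 0#
    convSum-[]ˡ zero    = zeroˡ _
    convSum-[]ˡ (suc m) = trans (cong₂ _+_ (convSum-[]ˡ m) (zeroˡ _)) (+-identityʳ 0#)

  mulCoeff-[]ʳ : ∀ a n → mulCoeff a [] n ≡ 0#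
  mulCoeff-[]ʳ a n = trans (mulCoeff-comm a [] n) (mulCoeff-[]ˡ a n)

  mulCoeff-∷ˡ : ∀ x xs b n → mulCoeff (x ∷ xs) b n ≡ x * coeff b n + shift (mulCoeff xs b) n
  mulCoeff-∷ˡ x xs b zero    = sym (+-identityʳ _)
  mulCoeff-∷ˡ x xs b (suc n) = convSum-∷ˡ n
    where
    convSum-∷ˡ : ∀ m → convSum (x ∷ xs) b (suc n) (suc m) ≡ x * coeff b (suc n) + convSum xs b n m
    convSum-∷ˡ zero    = refl
    convSum-∷ˡ (suc m) =
      trans (cong (_+ coeff xs (suc m) * coeff b (n ∸ suc m)) (convSum-∷ˡ m)) (+-assoc _ _ _)

  mulCoeff-padˡ : ∀ m L b → mulCoeff (replicate m 0# ++ L) b ≗ shiftBy m (mulCoeff L b)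
  mulCoeff-padˡ zero    L b n = refl
  mulCoeff-padˡ (suc m) L b n = begin
    mulCoeff (0# ∷ replicate m 0# ++ L) b n
      ≡⟨ mulCoeff-∷ˡ 0# _ b n ⟩
    0# * coeff b n + shift (mulCoeff (replicate m 0# ++ L) b) n
      ≡⟨ cong₂ _+_ (zeroˡ _) (shift-cong (mulCoeff-padˡ m L b) n) ⟩
    0# + shiftBy (suc m) (mulCoeff L b) n
      ≡⟨ +-identityˡ _ ⟩
    shiftBy (suc m) (mulCoeff L b) n
      ∎

  coeff-length : ∀ a → coeff a (length a) ≡ 0#
  coeff-length []       = refl
  coeff-length (x ∷ xs) = coeff-length xs

  coeff-replicate-++-< : ∀ m y L {n} → n ℕ.< m → coeff (replicate m y ++ L) n ≡ y
  coeff-replicate-++-< (suc m) y L {zero}  _         = refl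
  coeff-replicate-++-< (suc m) y L {suc n} (s≤s n<m) = coeff-replicate-++-< m y L n<m

  coeff-replicate-++-+ : ∀ m y L n → coeff (replicate m y ++ L) (m ℕ.+ n) ≡ coeff L n
  coeff-replicate-++-+ zero    y L n = refl
  coeff-replicate-++-+ (suc m) y L n = coeff-replicate-++-+ m y L n

module Inflation (ℝ : RealField) (p : ℕ) where
  open RealField ℝ
  open Poly ℝ
  open Convolution ℝ
  open ≡-Reasoning

  I : ℕ
  I = suc p

  -- inflate j a = a(xᴵ)(1 + x + ⋯ + xʲ): each coefficient of a becomes a block of I coefficients,
  -- j + 1 copies of it followed by I − (j + 1) zeros (for j ≤ p).
  inflate : ℕ → Polynomial → Polynomial
  inflate j []       = []
  inflate j (x ∷ xs) = replicate (suc j) x ++ (replicate (p ∸ j) 0# ++ inflate j xs)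

  dilate : Polynomial → Polynomial
  dilate = inflate 0

  section : ℕ → ℕ → Polynomial → Polynomial
  section j r a with r ℕ.≤? j
  ... | yes _ = a
  ... | no  _ = []

  byDivision : {P : ℕ → Set} → (∀ q r → r ℕ.< I → P (q ℕ.* I ℕ.+ r)) → ∀ n → P n
  byDivision {P} P-qr n = subst P (sym n≡qI+r) (P-qr (n / I) (n % I) (m%n<n n I))
    where
    n≡qI+r : n ≡ n / I ℕ.* I ℕ.+ n % I
    n≡qI+r = trans (m≡m%n+[m/n]*n n I) (ℕₚ.+-comm (n % I) _)

  coeff-inflate-next : ∀ {j} → j ℕ.≤ p → ∀ x xs q r →
    coeff (inflate j (x ∷ xs)) (suc q ℕ.* I ℕ.+ r) ≡ coeff (inflate j xs) (q ℕ.* I ℕ.+ r)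
  coeff-inflate-next {j} j≤p x xs q r = begin
    coeff (inflate j (x ∷ xs)) (suc q ℕ.* I ℕ.+ r)
      ≡⟨ cong (coeff (inflate j (x ∷ xs))) index ⟩
    coeff (inflate j (x ∷ xs)) (suc j ℕ.+ ((p ∸ j) ℕ.+ (q ℕ.* I ℕ.+ r)))
      ≡⟨ coeff-replicate-++-+ (suc j) x _ _ ⟩
    coeff (replicate (p ∸ j) 0# ++ inflate j xs) ((p ∸ j) ℕ.+ (q ℕ.* I ℕ.+ r))
      ≡⟨ coeff-replicate-++-+ (p ∸ j) 0# _ _ ⟩
    coeff (inflate j xs) (q ℕ.* I ℕ.+ r)
      ∎
    where
    index : suc q ℕ.* I ℕ.+ r ≡ suc j ℕ.+ ((p ∸ j) ℕ.+ (q ℕ.* I ℕ.+ r))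
    index = trans (ℕₚ.+-assoc I (q ℕ.* I) r)
                  (trans (cong (λ s → suc s ℕ.+ (q ℕ.* I ℕ.+ r)) (sym (ℕₚ.m+[n∸m]≡n j≤p)))
                         (cong suc (ℕₚ.+-assoc j (p ∸ j) _)))

  coeff-inflate-≤ : ∀ {j} → j ℕ.≤ p → ∀ a q {r} → r ℕ.≤ j →
                    coeff (inflate j a) (q ℕ.* I ℕ.+ r) ≡ coeff a q
  coeff-inflate-≤ j≤p []       q       r≤j = refl
  coeff-inflate-≤ j≤p (x ∷ xs) zero    r≤j = coeff-replicate-++-< _ x _ (s≤s r≤j)
  coeff-inflate-≤ j≤p (x ∷ xs) (suc q) r≤j =
    trans (coeff-inflate-next j≤p x xs q _) (coeff-inflate-≤ j≤p xs q r≤j)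

  coeff-inflate-> : ∀ {j} a q {r} → j ℕ.< r → r ℕ.< I →
                    coeff (inflate j a) (q ℕ.* I ℕ.+ r) ≡ 0#
  coeff-inflate-> []       q       j<r r<I = refl
  coeff-inflate-> {j} (x ∷ xs) zero j<r r<I with ℕₚ.m≤n⇒∃[o]m+o≡n j<r
  ... | t , refl =
    trans (coeff-replicate-++-+ (suc j) x _ t)
          (coeff-replicate-++-< (p ∸ j) 0# _
            (subst (ℕ._< p ∸ j) (ℕₚ.m+n∸m≡n (suc j) t) (ℕₚ.∸-monoˡ-< r<I (ℕₚ.m≤m+n (suc j) t))))
  coeff-inflate-> (x ∷ xs) (suc q) j<r r<I =
    trans (coeff-inflate-next (ℕₚ.≤-pred (ℕₚ.<-trans j<r r<I)) x xs q _) (coeff-inflate-> xs q j<r r<I)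

  coeff-inflate : ∀ {j} → j ℕ.≤ p → ∀ a q {r} → r ℕ.< I →
                  coeff (inflate j a) (q ℕ.* I ℕ.+ r) ≡ coeff (section j r a) q
  coeff-inflate {j} j≤p a q {r} r<I with r ℕ.≤? j
  ... | yes r≤j = coeff-inflate-≤ j≤p a q r≤j
  ... | no  r≰j = coeff-inflate-> a q (ℕₚ.≰⇒> r≰j) r<I

  section-all : ∀ (P : Carrier → Set) j r a → (∀ n → P (coeff a n)) →
                ∀ n → P (coeff (section j r a) n)
  section-all P j r a P-a with r ℕ.≤? j
  ... | yes _ = P-a
  ... | no  _ = λ _ → subst P (coeff-length a) (P-a (length a))

  inflate-all : ∀ (P : Carrier → Set) {j} → j ℕ.≤ p → ∀ a →
                (∀ n → P (coeff a n)) → ∀ n → P (coeff (inflate j a) n)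
  inflate-all P {j} j≤p a P-a = byDivision λ q r r<I →
    subst P (sym (coeff-inflate j≤p a q r<I)) (section-all P j r a P-a q)

  mulCoeff-dilate : ∀ b {F G r} → r ℕ.< I → (∀ q → coeff F (q ℕ.* I ℕ.+ r) ≡ coeff G q) →
                    ∀ q → mulCoeff (dilate b) F (q ℕ.* I ℕ.+ r) ≡ mulCoeff b G q
  mulCoeff-dilate []       {F} {G} {r} r<I F≡G q =
    trans (mulCoeff-[]ˡ F (q ℕ.* I ℕ.+ r)) (sym (mulCoeff-[]ˡ G q))
  mulCoeff-dilate (x ∷ xs) {F} {G} {r} r<I F≡G q = begin
    mulCoeff (dilate (x ∷ xs)) F (q ℕ.* I ℕ.+ r)
      ≡⟨ mulCoeff-∷ˡ x _ F _ ⟩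
    x * coeff F (q ℕ.* I ℕ.+ r) + shift (mulCoeff (replicate p 0# ++ dilate xs) F) (q ℕ.* I ℕ.+ r)
      ≡⟨ cong₂ _+_ (cong (x *_) (F≡G q)) (shift-cong (mulCoeff-padˡ p (dilate xs) F) (q ℕ.* I ℕ.+ r)) ⟩
    x * coeff G q + shiftBy I (mulCoeff (dilate xs) F) (q ℕ.* I ℕ.+ r)
      ≡⟨ cong (x * coeff G q +_) (shiftBy-section I _ r<I q) ⟩
    x * coeff G q + shift (λ q → mulCoeff (dilate xs) F (q ℕ.* I ℕ.+ r)) q
      ≡⟨ cong (x * coeff G q +_) (shift-cong (mulCoeff-dilate xs r<I F≡G) q) ⟩
    x * coeff G q + shift (mulCoeff xs G) q
      ≡⟨ sym (mulCoeff-∷ˡ x xs G q) ⟩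
    mulCoeff (x ∷ xs) G q
      ∎

  section-isProduct : ∀ j r {c a b} → IsProduct c a b → IsProduct (section j r c) b (section j r a)
  section-isProduct j r {a = a} {b} c≡ab with r ℕ.≤? j
  ... | yes _ = λ n → trans (c≡ab n) (mulCoeff-comm a b n)
  ... | no  _ = λ n → sym (mulCoeff-[]ʳ b n)

  inflate-isProduct : ∀ {j} → j ℕ.≤ p → ∀ {c a b} → IsProduct c a b →
                      IsProduct (inflate j c) (inflate j a) (dilate b)
  inflate-isProduct {j} j≤p {c} {a} {b} c≡ab = byDivision λ q r r<I → begin
    coeff (inflate j c) (q ℕ.* I ℕ.+ r)
      ≡⟨ coeff-inflate j≤p c q r<I ⟩
    coeff (section j r c) q
      ≡⟨ section-isProduct j r c≡ab q ⟩
    mulCoeff b (section j r a) q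
      ≡⟨ mulCoeff-dilate b {inflate j a} r<I (λ q → coeff-inflate j≤p a q r<I) q ⟨
    mulCoeff (dilate b) (inflate j a) (q ℕ.* I ℕ.+ r)
      ≡⟨ mulCoeff-comm (dilate b) (inflate j a) (q ℕ.* I ℕ.+ r) ⟩
    mulCoeff (inflate j a) (dilate b) (q ℕ.* I ℕ.+ r)
      ∎

  inflate-hasDegree : ∀ {j} → j ℕ.≤ p → ∀ {a d} → HasDegree a d →
                      HasDegree (inflate j a) (d ℕ.* I ℕ.+ j)
  inflate-hasDegree {j} j≤p {a} {d} (a-d≢0 , a-beyond) =
    (λ e → a-d≢0 (trans (sym (coeff-inflate-≤ j≤p a d ℕₚ.≤-refl)) e)) ,
    byDivision λ q r r<I dI+j<qI+r → trans (coeff-inflate j≤p a q r<I) (beyond q r dI+j<qI+r)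
    where
    beyond : ∀ q r → d ℕ.* I ℕ.+ j ℕ.< q ℕ.* I ℕ.+ r → coeff (section j r a) q ≡ 0#
    beyond q r dI+j<qI+r with r ℕ.≤? j
    ... | yes r≤j = a-beyond q (ℕₚ.≰⇒> λ q≤d →
                      ℕₚ.<⇒≱ dI+j<qI+r (ℕₚ.+-mono-≤ (ℕₚ.*-monoˡ-≤ I q≤d) r≤j))
    ... | no  _   = refl

  inflate-witnesses : ∀ {α j c a b} → j ℕ.≤ p → Witnesses α c a b →
                      Witnesses α (inflate j c) (inflate j a) (dilate b)
  inflate-witnesses {α} {c = c} {a} {b} j≤p
    (c-01 , c≡ab , a₀≡1 , b₀≡1 , (i , bᵢ≢0 , bᵢ≢1) , b-bnd , a-bnd) =
    inflate-all (λ z → (z ≡ 0#) ⊎ (z ≡ 1#)) j≤p c c-01 ,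
    inflate-isProduct j≤p {c} {a} {b} c≡ab ,
    trans (coeff-inflate-≤ j≤p a 0 z≤n) a₀≡1 ,
    trans (coeff-inflate-≤ z≤n b 0 z≤n) b₀≡1 ,
    (i ℕ.* I ℕ.+ 0 , bᵢ≢0 ∘ trans bᵢ≡Bᵢ , bᵢ≢1 ∘ trans bᵢ≡Bᵢ) ,
    inflate-all (λ z → ((- α) ≤ z) × (z ≤ 1# + α)) z≤n b b-bnd ,
    inflate-all (λ z → ((- α) ≤ z) × (z ≤ 1# + α)) j≤p a a-bnd
    where
    bᵢ≡Bᵢ : coeff b i ≡ coeff (dilate b) (i ℕ.* I ℕ.+ 0)
    bᵢ≡Bᵢ = sym (coeff-inflate-≤ z≤n b i z≤n)

mainTheorem2 : (ℝ : RealField) → Theorem2 ℝ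
mainTheorem2 ℝ _ _ _ _ _                   zero    _ () _
mainTheorem2 ℝ _ _ k _ (c , a , b , w , a-deg) (suc p) j _ (s≤s j≤p) =
  inflate j c , inflate j a , dilate b , inflate-witnesses {c = c} {a} {b} j≤p w ,
  subst (HasDegree (inflate j a)) (cong (ℕ._+ j) (ℕₚ.*-comm k (suc p))) (inflate-hasDegree j≤p {a} a-deg)
  where
  open Poly ℝ
  open Inflation ℝ p
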